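{- Let $q,x\in\mathbb{C}$. For any positive integer $n$, $$\det[q^{|j-k|}+x\delta_{jk}]_{1\le j,k\le n}=(x+1)\,u_n\big(1-q^2+(1+q^2)x,\ q^2x^2\big)-q^2x^2\,u_{n-1}\big(1-q^2+(1+q^2)x,\ q^2x^2\big),$$ where $\delta_{jk}$ is $1$ if $j=k$ and $0$ otherwise.
   Context: For $a,b\in\mathbb{C}$, the Lucas sequence $(u_n(a,b))_{n\ge0}$ is defined by $u_0(a,b)=0$, $u_1(a,b)=1$, and $u_{n+1}(a,b)=au_n(a,b)-bu_{n-1}(a,b)$ for $n\ge1$. The convention $0^0=1$ is used. -}

module Defs where

open import Level using (Level)
open import Algebra.Bundles using (CommutativeRing)
open import Data.Nat using (ℕ; zero; suc; ∣_-_∣)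
open import Data.Fin using (Fin; zero; suc; toℕ; punchIn; _≟_)
open import Relation.Nullary using (yes; no)

module _ {c ℓ : Level} (R : CommutativeRing c ℓ) where
  open CommutativeRing R using (Carrier; _+_; _*_; -_; _-_; 0#; 1#)

  pow : Carrier → ℕ → Carrier
  pow x zero    = 1#
  pow x (suc n) = x * pow x n

  sumFin : ∀ {n} → (Fin n → Carrier) → Carrier
  sumFin {zero}  f = 0#
  sumFin {suc n} f = f zero + sumFin (λ i → f (suc i))

  det : ∀ {n} → (Fin n → Fin n → Carrier) → Carrier
  det {zero}  M = 1#
  det {suc n} M =
    sumFin (λ j → pow (- 1#) (toℕ j) * (M zero j * det (λ i k → M (suc i) (punchIn j k))))

  δ : ∀ {n} → Fin n → Fin n → Carrier
  δ j k with j ≟ k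
  ... | yes _ = 1#
  ... | no  _ = 0#

  lucasU : Carrier → Carrier → ℕ → Carrier
  lucasU a b zero          = 0#
  lucasU a b (suc zero)    = 1#
  lucasU a b (suc (suc n)) = a * lucasU a b (suc n) - b * lucasU a b n

  qMatrix : (q x : Carrier) (n : ℕ) → Fin n → Fin n → Carrier
  qMatrix q x n j k = pow q ∣ toℕ j - toℕ k ∣ + x * δ j k

{-# OPTIONS --safe #-}
-- Let a n be the determinant of the n × n matrix and P s t the matrix with its first column replaced by
-- (s, t q, t q², …). Subtracting q times the second row from the first leaves only two
-- nonzero entries in the first row, so det P s t = (s − t q²) a + q x det P′ (t q) (t q)
-- with P′ one size smaller. For s = t this gives det P t t = t (a (n + 1) − x a n), and
-- for the matrix itself (s = 1 + x, t = 1) the recurrence a (n + 2) = A a (n + 1) − B a n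
-- with A = 1 − q² + (1 + q²) x and B = q² x². Every solution of that recurrence is
-- a 1 · u (n + 1) − B a 0 · u n, and a 0 = 1, a 1 = x + 1.
module Submission where

open import Defs
open import Level using (Level)
open import Algebra.Bundles using (CommutativeRing)
open import Data.Nat using (ℕ; _≤_; _∸_)

open import Data.Nat as ℕ using (zero; suc)
import Data.Nat.Properties as ℕₚ
open import Data.Fin using (Fin; zero; suc; toℕ; punchIn; _≟_)
open import Data.Vec.Functional using (_∷_; tail)
open import Data.Integer as ℤ using (ℤ; +_; -[1+_]; +[1+_]; _⊖_)
import Data.Integer.Properties as ℤₚ
open import Data.Maybe using (Maybe; just; nothing)
open import Function using (_∘_)
open import Relation.Nullary using (yes; no)
open import Relation.Binary.PropositionalEquality as ≡ using (_≡_; _≗_)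
open import Algebra.Solver.Ring.AlmostCommutativeRing
  using (fromCommutativeRing; _-Raw-AlmostCommutative⟶_)

-- The ring solver needs coefficients with decidable equality; ℤ is embedded through the
-- optimised multiple n × 1#, under which con (+ 1) evaluates to 1# itself.
module IntegerCoefficients {c ℓ : Level} (R : CommutativeRing c ℓ) where
  open CommutativeRing R hiding (zero)
  open import Algebra.Properties.Ring ring using (-‿involutive; -‿distribˡ-*; -‿+-comm; -0#≈0#)
  open import Algebra.Properties.AbelianGroup +-abelianGroup using (xyx⁻¹≈y)
  open import Algebra.Properties.Semiring.Mult.TCOptimised semiring using (_×_; 1+×; ×-homo-+)
  open import Relation.Binary.Reasoning.Setoid setoid

  fromℤ : ℤ → Carrier
  fromℤ (+ n)    = n × 1#
  fromℤ -[1+ n ] = - (suc n × 1#)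

  fromℤ-neg : ∀ i → fromℤ (ℤ.- i) ≈ - fromℤ i
  fromℤ-neg (+ zero)  = sym -0#≈0#
  fromℤ-neg +[1+ n ]  = refl
  fromℤ-neg -[1+ n ]  = sym (-‿involutive _)

  fromℤ-⊖ : ∀ m n → fromℤ (m ⊖ n) ≈ m × 1# - n × 1#
  fromℤ-⊖ m       zero    = sym (trans (+-congˡ -0#≈0#) (+-identityʳ _))
  fromℤ-⊖ zero    (suc n) = sym (+-identityˡ _)
  fromℤ-⊖ (suc m) (suc n) = begin
    fromℤ (suc m ⊖ suc n)           ≡⟨ ≡.cong fromℤ (ℤₚ.[1+m]⊖[1+n]≡m⊖n m n) ⟩
    fromℤ (m ⊖ n)                   ≈⟨ fromℤ-⊖ m n ⟩
    m × 1# - n × 1#                 ≈⟨ +-congʳ (sym (xyx⁻¹≈y 1# (m × 1#))) ⟩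
    1# + m × 1# - 1# - n × 1#       ≈⟨ +-assoc _ _ _ ⟩
    1# + m × 1# + (- 1# - n × 1#)   ≈⟨ +-congˡ (-‿+-comm 1# (n × 1#)) ⟩
    1# + m × 1# - (1# + n × 1#)     ≈⟨ +-cong (1+× m 1#) (-‿cong (1+× n 1#)) ⟨
    suc m × 1# - suc n × 1#         ∎

  fromℤ-+ : ∀ i j → fromℤ (i ℤ.+ j) ≈ fromℤ i + fromℤ j
  fromℤ-+ (+ m)    (+ n)    = ×-homo-+ 1# m n
  fromℤ-+ (+ m)    -[1+ n ] = fromℤ-⊖ m (suc n)
  fromℤ-+ -[1+ m ] (+ n)    = trans (fromℤ-⊖ n (suc m)) (+-comm _ _)
  fromℤ-+ -[1+ m ] -[1+ n ] = begin
    - (suc (suc (m ℕ.+ n)) × 1#)     ≡⟨ ≡.cong (λ k → - (suc k × 1#)) (≡.sym (ℕₚ.+-suc m n)) ⟩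
    - ((suc m ℕ.+ suc n) × 1#)       ≈⟨ -‿cong (×-homo-+ 1# (suc m) (suc n)) ⟩
    - (suc m × 1# + suc n × 1#)      ≈⟨ sym (-‿+-comm _ _) ⟩
    - (suc m × 1#) + - (suc n × 1#)  ∎

  fromℤ-+* : ∀ n j → fromℤ (+ n ℤ.* j) ≈ n × 1# * fromℤ j
  fromℤ-+* zero    j = sym (zeroˡ _)
  fromℤ-+* (suc n) j = begin
    fromℤ (+[1+ n ] ℤ.* j)           ≡⟨ ≡.cong fromℤ (ℤₚ.suc-* (+ n) j) ⟩
    fromℤ (j ℤ.+ + n ℤ.* j)          ≈⟨ fromℤ-+ j (+ n ℤ.* j) ⟩
    fromℤ j + fromℤ (+ n ℤ.* j)      ≈⟨ +-cong (sym (*-identityˡ _)) (fromℤ-+* n j) ⟩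
    1# * fromℤ j + n × 1# * fromℤ j  ≈⟨ distribʳ _ _ _ ⟨
    (1# + n × 1#) * fromℤ j          ≈⟨ *-congʳ (1+× n 1#) ⟨
    suc n × 1# * fromℤ j             ∎

  fromℤ-* : ∀ i j → fromℤ (i ℤ.* j) ≈ fromℤ i * fromℤ j
  fromℤ-* (+ n)    j = fromℤ-+* n j
  fromℤ-* -[1+ n ] j = begin
    fromℤ (-[1+ n ] ℤ.* j)           ≡⟨ ≡.cong fromℤ (≡.sym (ℤₚ.neg-distribˡ-* +[1+ n ] j)) ⟩
    fromℤ (ℤ.- (+[1+ n ] ℤ.* j))     ≈⟨ fromℤ-neg (+[1+ n ] ℤ.* j) ⟩
    - fromℤ (+[1+ n ] ℤ.* j)         ≈⟨ -‿cong (fromℤ-+* (suc n) j) ⟩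
    - (suc n × 1# * fromℤ j)         ≈⟨ -‿distribˡ-* _ _ ⟩
    - (suc n × 1#) * fromℤ j         ∎

  fromℤ-homomorphism : ℤ.+-*-rawRing -Raw-AlmostCommutative⟶ fromCommutativeRing R
  fromℤ-homomorphism = record
    { ⟦_⟧ = fromℤ ; +-homo = fromℤ-+ ; *-homo = fromℤ-* ; -‿homo = fromℤ-neg
    ; 0-homo = refl ; 1-homo = refl }

  fromℤ-≟ : ∀ i j → Maybe (fromℤ i ≈ fromℤ j)
  fromℤ-≟ i j with i ℤ.≟ j
  ... | yes i≡j = just (reflexive (≡.cong fromℤ i≡j))
  ... | no _    = nothing

  open import Algebra.Solver.Ring ℤ.+-*-rawRing (fromCommutativeRing R) fromℤ-homomorphism fromℤ-≟ public

  :0 :1 : ∀ {n} → Polynomial n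
  :0 = con (+ 0)
  :1 = con (+ 1)

module LinearRecurrence {c ℓ : Level} (R : CommutativeRing c ℓ) where
  open CommutativeRing R hiding (zero)
  open IntegerCoefficients R using (solve; _:=_; _:*_; _:-_; :0; :1)
  open import Data.Product using (_×_; _,_; proj₁)
  open import Relation.Binary.Reasoning.Setoid setoid

  LucasRecurrence : Carrier → Carrier → (ℕ → Carrier) → Set ℓ
  LucasRecurrence A B f = ∀ n → f (suc (suc n)) ≈ A * f (suc n) - B * f n

  lucasU-recurrence : ∀ A B → LucasRecurrence A B (lucasU R A B)
  lucasU-recurrence A B n = refl

  recurrence-shift : ∀ {A B f} → LucasRecurrence A B f → LucasRecurrence A B (f ∘ suc)
  recurrence-shift rec n = rec (suc n)

  recurrence-combination : ∀ {A B f g} α β → LucasRecurrence A B f → LucasRecurrence A B g →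
                           LucasRecurrence A B (λ n → α * f n - β * g n)
  recurrence-combination {A} {B} {f} {g} α β recf recg n = begin
    α * f (suc (suc n)) - β * g (suc (suc n))
      ≈⟨ +-cong (*-congˡ (recf n)) (-‿cong (*-congˡ (recg n))) ⟩
    α * (A * f (suc n) - B * f n) - β * (A * g (suc n) - B * g n)
      ≈⟨ solve 8 (λ α β A B f₀ f₁ g₀ g₁ → α :* (A :* f₁ :- B :* f₀) :- β :* (A :* g₁ :- B :* g₀)
                                       := A :* (α :* f₁ :- β :* g₁) :- B :* (α :* f₀ :- β :* g₀))
               refl α β A B (f n) (f (suc n)) (g n) (g (suc n)) ⟩
    A * (α * f (suc n) - β * g (suc n)) - B * (α * f n - β * g n) ∎

  recurrence-unique : ∀ {A B f g} → LucasRecurrence A B f → LucasRecurrence A B g →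
                      f 0 ≈ g 0 → f 1 ≈ g 1 → ∀ n → f n ≈ g n
  recurrence-unique {A} {B} {f} {g} recf recg f₀≈g₀ f₁≈g₁ n = proj₁ (consecutive n)
    where
    consecutive : ∀ n → (f n ≈ g n) × (f (suc n) ≈ g (suc n))
    consecutive zero    = f₀≈g₀ , f₁≈g₁
    consecutive (suc n) with consecutive n
    ... | fₙ≈gₙ , fₙ₊₁≈gₙ₊₁ =
      fₙ₊₁≈gₙ₊₁ , trans (recf n) (trans (+-cong (*-congˡ fₙ₊₁≈gₙ₊₁) (-‿cong (*-congˡ fₙ≈gₙ))) (sym (recg n)))

  recurrence⇒lucasU : ∀ {A B f} → LucasRecurrence A B f →
                      ∀ n → f (suc n) ≈ f 1 * lucasU R A B (suc n) - (B * f 0) * lucasU R A B n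
  recurrence⇒lucasU {A} {B} {f} rec = recurrence-unique (recurrence-shift rec) lucasCombination initial₀ initial₁
    where
    U : ℕ → Carrier
    U = lucasU R A B
    lucasCombination : LucasRecurrence A B (λ n → f 1 * U (suc n) - (B * f 0) * U n)
    lucasCombination = recurrence-combination (f 1) (B * f 0)
                         (recurrence-shift (lucasU-recurrence A B)) (lucasU-recurrence A B)
    initial₀ : f 1 ≈ f 1 * 1# - (B * f 0) * 0#
    initial₀ = solve 2 (λ f₁ c → f₁ := f₁ :* :1 :- c :* :0) refl (f 1) (B * f 0)
    initial₁ : f 2 ≈ f 1 * (A * 1# - B * 0#) - (B * f 0) * 1#
    initial₁ = trans (rec 0) (solve 4 (λ A B f₀ f₁ → A :* f₁ :- B :* f₀
                := f₁ :* (A :* :1 :- B :* :0) :- (B :* f₀) :* :1) refl A B (f 0) (f 1))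

module Determinant {c ℓ : Level} (R : CommutativeRing c ℓ) where
  open CommutativeRing R hiding (zero)
  open IntegerCoefficients R using (solve; _:=_; _:+_; _:*_; :-_; :1)
  open import Relation.Binary.Reasoning.Setoid setoid

  Matrix : ℕ → ℕ → Set c
  Matrix m n = Fin m → Fin n → Carrier

  sgn : ∀ {n} → Fin n → Carrier
  sgn j = pow R (- 1#) (toℕ j)

  sumFin-cong : ∀ {n} {f g : Fin n → Carrier} → (∀ i → f i ≈ g i) → sumFin R f ≈ sumFin R g
  sumFin-cong {zero}  f≈g = refl
  sumFin-cong {suc n} f≈g = +-cong (f≈g zero) (sumFin-cong (f≈g ∘ suc))

  sumFin-zero : ∀ {n} {f : Fin n → Carrier} → (∀ i → f i ≈ 0#) → sumFin R f ≈ 0#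
  sumFin-zero {zero}  f≈0 = refl
  sumFin-zero {suc n} f≈0 = trans (+-cong (f≈0 zero) (sumFin-zero (f≈0 ∘ suc))) (+-identityʳ 0#)

  sumFin-+ : ∀ {n} (f g : Fin n → Carrier) → sumFin R (λ i → f i + g i) ≈ sumFin R f + sumFin R g
  sumFin-+ {zero}  f g = sym (+-identityʳ 0#)
  sumFin-+ {suc n} f g = trans (+-congˡ (sumFin-+ (f ∘ suc) (g ∘ suc)))
    (solve 4 (λ a b c d → (a :+ b) :+ (c :+ d) := (a :+ c) :+ (b :+ d)) refl (f zero) (g zero) _ _)

  *-distribˡ-sumFin : ∀ {n} a (f : Fin n → Carrier) → a * sumFin R f ≈ sumFin R (λ i → a * f i)
  *-distribˡ-sumFin {zero}  a f = zeroʳ a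
  *-distribˡ-sumFin {suc n} a f = trans (distribˡ _ _ _) (+-congˡ (*-distribˡ-sumFin a (f ∘ suc)))

  det-cong : ∀ {n} {M N : Matrix n n} → (∀ i j → M i j ≈ N i j) → det R M ≈ det R N
  det-cong {zero}  M≈N = refl
  det-cong {suc n} M≈N = sumFin-cong λ j →
    *-congˡ {x = sgn j} (*-cong (M≈N zero j) (det-cong (λ i k → M≈N (suc i) (punchIn j k))))

  -- det (v ∷ w ∷ M) unfolds to laplace₂ v w Ψ, where Ψ σ is the minor of M on the columns σ.
  laplace₂ : ∀ {m} (v w : Fin (suc (suc m)) → Carrier) → ((Fin m → Fin (suc (suc m))) → Carrier) → Carrier
  laplace₂ v w Ψ = sumFin R λ j → sgn j * (v j * sumFin R λ k →
                     sgn k * (w (punchIn j k) * Ψ (punchIn j ∘ punchIn k)))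

  det-linearˡ : ∀ {n} (r s : Fin (suc n) → Carrier) a (M : Matrix n (suc n)) →
                det R ((λ k → r k + a * s k) ∷ M) ≈ det R (r ∷ M) + a * det R (s ∷ M)
  det-linearˡ {n} r s a M = begin
    sumFin R (λ j → sgn j * ((r j + a * s j) * D j))
      ≈⟨ sumFin-cong {suc n} (λ j → solve 5 (λ σ r a s d → σ :* ((r :+ a :* s) :* d) := σ :* (r :* d) :+ a :* (σ :* (s :* d)))
                                    refl (sgn j) (r j) a (s j) (D j)) ⟩
    sumFin R (λ j → sgn j * (r j * D j) + a * (sgn j * (s j * D j)))
      ≈⟨ sumFin-+ (λ j → sgn j * (r j * D j)) (λ j → a * (sgn j * (s j * D j))) ⟩
    det R (r ∷ M) + sumFin R (λ j → a * (sgn j * (s j * D j)))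
      ≈⟨ +-congˡ (*-distribˡ-sumFin a (λ j → sgn j * (s j * D j))) ⟨
    det R (r ∷ M) + a * det R (s ∷ M) ∎
    where
    D : Fin _ → Carrier
    D j = det R (λ i k → M i (punchIn j k))

  -- For equal rows the term (0, k) cancels the term (k + 1, 0): both delete columns 0 and k + 1.
  laplace₂-peel : ∀ {m} (v : Fin (suc (suc m)) → Carrier) (Ψ : (Fin m → Fin (suc (suc m))) → Carrier) →
                  laplace₂ v v Ψ ≈ sumFin R λ j → sgn j * (v (suc j) * sumFin R λ k →
                    sgn k * (v (suc (punchIn j k)) * Ψ (punchIn (suc j) ∘ punchIn (suc k))))
  laplace₂-peel {m} v Ψ = begin
    laplace₂ v v Ψ                                           ≈⟨ +-cong term₀ (sumFin-cong {suc m} termSuc) ⟩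
    sumFin R G + sumFin R (λ j → - 1# * G j + K j)           ≈⟨ +-congˡ (sumFin-+ (λ j → - 1# * G j) K) ⟩
    sumFin R G + (sumFin R (λ j → - 1# * G j) + sumFin R K)  ≈⟨ +-congˡ (+-congʳ (*-distribˡ-sumFin (- 1#) G)) ⟨
    sumFin R G + (- 1# * sumFin R G + sumFin R K)            ≈⟨ solve 2 (λ g k → g :+ (:- :1 :* g :+ k) := k)
                                                                         refl (sumFin R G) (sumFin R K) ⟩
    sumFin R K                                               ∎
    where
    Φ : Fin (suc m) → Carrier
    Φ k = Ψ (suc ∘ punchIn k)
    Y : Fin (suc m) → Fin m → Carrier
    Y j k = v (suc (punchIn j k)) * Ψ (punchIn (suc j) ∘ punchIn (suc k))
    Z : Fin (suc m) → Carrier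
    Z j = sumFin R (λ k → sgn k * Y j k)
    G K : Fin (suc m) → Carrier
    G j = sgn j * (v (suc j) * (v zero * Φ j))
    K j = sgn j * (v (suc j) * Z j)
    term₀ : 1# * (v zero * sumFin R (λ k → sgn k * (v (suc k) * Φ k))) ≈ sumFin R G
    term₀ = trans (*-identityˡ _) (trans (*-distribˡ-sumFin (v zero) (λ k → sgn k * (v (suc k) * Φ k)))
      (sumFin-cong λ k → solve 4 (λ a σ b φ → a :* (σ :* (b :* φ)) := σ :* (b :* (a :* φ)))
                                 refl (v zero) (sgn k) (v (suc k)) (Φ k)))
    termSuc : ∀ j → (- 1# * sgn j) * (v (suc j) * (1# * (v zero * Φ j) + sumFin R (λ k → (- 1# * sgn k) * Y j k)))
                    ≈ - 1# * G j + K j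
    termSuc j = begin
      (- 1# * sgn j) * (v (suc j) * (1# * (v zero * Φ j) + sumFin R (λ k → (- 1# * sgn k) * Y j k)))
        ≈⟨ *-congˡ (*-congˡ (+-congˡ (trans (sumFin-cong λ k → *-assoc (- 1#) (sgn k) (Y j k))
                                            (sym (*-distribˡ-sumFin (- 1#) (λ k → sgn k * Y j k)))))) ⟩
      (- 1# * sgn j) * (v (suc j) * (1# * (v zero * Φ j) + - 1# * Z j))
        ≈⟨ solve 5 (λ σ b a φ z → (:- :1 :* σ) :* (b :* (:1 :* (a :* φ) :+ :- :1 :* z))
                                 := :- :1 :* (σ :* (b :* (a :* φ))) :+ σ :* (b :* z))
                   refl (sgn j) (v (suc j)) (v zero) (Φ j) (Z j) ⟩
      - 1# * G j + K j ∎

  laplace₂-diagonal : ∀ {m} (v : Fin (suc (suc m)) → Carrier) (Ψ : (Fin m → Fin (suc (suc m))) → Carrier) →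
                      (∀ {σ τ} → σ ≗ τ → Ψ σ ≈ Ψ τ) → laplace₂ v v Ψ ≈ 0#
  laplace₂-diagonal {zero} v Ψ Ψ-cong =
    trans (laplace₂-peel v Ψ) (sumFin-zero λ j → trans (*-congˡ (zeroʳ (v (suc j)))) (zeroʳ (sgn j)))
  laplace₂-diagonal {suc m} v Ψ Ψ-cong =
    trans (laplace₂-peel v Ψ)
      (trans (sumFin-cong λ j → *-congˡ {x = sgn j} (*-congˡ {x = v (suc j)} (sumFin-cong λ k →
                *-congˡ {x = sgn k} (*-congˡ {x = v (suc (punchIn j k))} (Ψ-cong (punchIn-suc j k))))))
             (laplace₂-diagonal (tail v) Ψ′ Ψ′-cong))
    where
    Ψ′ : (Fin m → Fin (suc (suc m))) → Carrier
    Ψ′ τ = Ψ (zero ∷ suc ∘ τ)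
    Ψ′-cong : ∀ {σ τ} → σ ≗ τ → Ψ′ σ ≈ Ψ′ τ
    Ψ′-cong σ≗τ = Ψ-cong λ { zero → ≡.refl ; (suc c) → ≡.cong suc (σ≗τ c) }
    punchIn-suc : ∀ j k → punchIn (suc j) ∘ punchIn (suc k) ≗ zero ∷ suc ∘ punchIn j ∘ punchIn k
    punchIn-suc j k zero    = ≡.refl
    punchIn-suc j k (suc c) = ≡.refl

  det-repeatedRow : ∀ {m} (r : Fin (suc (suc m)) → Carrier) (M : Matrix m (suc (suc m))) →
                    det R (r ∷ r ∷ M) ≈ 0#
  det-repeatedRow r M = laplace₂-diagonal r (λ σ → det R (λ i c → M i (σ c)))
                          (λ σ≗τ → det-cong λ i c → reflexive (≡.cong (M i) (σ≗τ c)))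

  det-addRow : ∀ {m} a (M : Matrix (suc (suc m)) (suc (suc m))) →
               det R ((λ k → M zero k + a * M (suc zero) k) ∷ tail M) ≈ det R M
  det-addRow a M = begin
    det R ((λ k → M zero k + a * M (suc zero) k) ∷ tail M)   ≈⟨ det-linearˡ (M zero) (M (suc zero)) a (tail M) ⟩
    det R M + a * det R (M (suc zero) ∷ M (suc zero) ∷ tail (tail M))
                                                           ≈⟨ +-congˡ (*-congˡ (det-repeatedRow (M (suc zero)) (tail (tail M)))) ⟩
    det R M + a * 0#                                       ≈⟨ +-congˡ (zeroʳ a) ⟩
    det R M + 0#                                           ≈⟨ +-identityʳ _ ⟩
    det R M                                                ∎

module QMatrix {c ℓ : Level} (R : CommutativeRing c ℓ) (q x : CommutativeRing.Carrier R) where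
  open CommutativeRing R hiding (zero)
  open IntegerCoefficients R using (solve; _:=_; _:+_; _:*_; _:-_; :-_; :0; :1)
  open Determinant R
  open LinearRecurrence R using (LucasRecurrence)
  open import Relation.Binary.Reasoning.Setoid setoid

  Q : ∀ n → Matrix n n
  Q = qMatrix R q x

  a : ℕ → Carrier
  a n = det R (Q n)

  P : Carrier → Carrier → ∀ n → Matrix n n
  P s t n zero    zero    = s
  P s t n (suc i) zero    = t * pow R q (suc (toℕ i))
  P s t n i       (suc k) = Q n i (suc k)

  δ-suc : ∀ {n} (i k : Fin n) → δ R (suc i) (suc k) ≡ δ R i k
  δ-suc i k with i ≟ k
  ... | yes _ = ≡.refl
  ... | no _  = ≡.refl

  Q-suc : ∀ {n} (i k : Fin n) → Q (suc n) (suc i) (suc k) ≈ Q n i k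
  Q-suc i k = +-congˡ (*-congˡ (reflexive (δ-suc i k)))

  a≈detP : ∀ n → a (suc n) ≈ det R (P (1# + x) 1# (suc n))
  a≈detP n = det-cong entries
    where
    entries : ∀ i k → Q (suc n) i k ≈ P (1# + x) 1# (suc n) i k
    entries zero    zero    = +-congˡ (*-identityʳ x)
    entries (suc i) zero    = solve 2 (λ p x → p :+ x :* :0 := :1 :* p) refl _ x
    entries zero    (suc k) = refl
    entries (suc i) (suc k) = refl

  detP-one : ∀ s t → det R (P s t 1) ≈ s
  detP-one s t = solve 1 (λ s → :1 :* (s :* :1) :+ :0 := s) refl s

  a-one : a 1 ≈ x + 1#
  a-one = solve 1 (λ x → :1 :* ((:1 :+ x :* :1) :* :1) :+ :0 := x :+ :1) refl x

  -- Subtracting q times row 1 turns row 0 into (s − t q², − q x, 0, …, 0).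
  detP-step : ∀ m s t → det R (P s t (suc (suc m))) ≈
              (s - t * (q * q)) * a (suc m) + (q * x) * det R (P (t * q) (t * q) (suc m))
  detP-step m s t = begin
    det R M                                        ≈⟨ det-addRow (- q) M ⟨
    det R (r ∷ tail M)                             ≈⟨ +-cong term₀ (+-cong term₁ (sumFin-zero term₂₊)) ⟩
    (s - t * (q * q)) * a (suc m) + ((q * x) * det R (P (t * q) (t * q) (suc m)) + 0#)
                                                   ≈⟨ +-congˡ (+-identityʳ _) ⟩
    (s - t * (q * q)) * a (suc m) + (q * x) * det R (P (t * q) (t * q) (suc m)) ∎
    where
    M : Matrix (suc (suc m)) (suc (suc m))
    M = P s t (suc (suc m))
    r : Fin (suc (suc m)) → Carrier
    r k = M zero k + - q * M (suc zero) k
    D : Fin (suc (suc m)) → Carrier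
    D j = det R (λ i k → M (suc i) (punchIn j k))
    term₀ : 1# * (r zero * D zero) ≈ (s - t * (q * q)) * a (suc m)
    term₀ = trans (*-congˡ (*-congˡ (det-cong {suc m} Q-suc)))
      (solve 4 (λ s t q d → :1 :* ((s :+ (:- q) :* (t :* (q :* :1))) :* d)
                            := (s :- t :* (q :* q)) :* d) refl s t q (a (suc m)))
    minor₁ : ∀ i k → M (suc i) (punchIn (suc zero) k) ≈ P (t * q) (t * q) (suc m) i k
    minor₁ zero    zero    = *-congˡ (*-identityʳ q)
    minor₁ (suc i) zero    = sym (*-assoc _ _ _)
    minor₁ zero    (suc k) = Q-suc zero (suc k)
    minor₁ (suc i) (suc k) = Q-suc (suc i) (suc k)
    term₁ : (- 1# * 1#) * (r (suc zero) * D (suc zero)) ≈ (q * x) * det R (P (t * q) (t * q) (suc m))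
    term₁ = trans (*-congˡ (*-congˡ (det-cong minor₁)))
      (solve 3 (λ q x d → (:- :1 :* :1) :* (((q :* :1 :+ x :* :0)
                            :+ (:- q) :* (:1 :+ x :* :1)) :* d) := (q :* x) :* d)
               refl q x _)
    term₂₊ : ∀ j → sgn (suc (suc j)) * (r (suc (suc j)) * D (suc (suc j))) ≈ 0#
    term₂₊ j = solve 5 (λ σ q p x d → σ :* (((q :* (q :* p) :+ x :* :0) :+ (:- q) :* (q :* p :+ x :* :0)) :* d)
                                     := :0)
                 refl (sgn (suc (suc j))) q (pow R q (toℕ j)) x (D (suc (suc j)))

  detP-diagonal : ∀ m t → det R (P t t (suc m)) ≈ t * (a (suc m) - x * a m)
  a-step : ∀ m → a (suc (suc m)) ≈ (1# + x - 1# * (q * q)) * a (suc m) + (q * x) * ((1# * q) * (a (suc m) - x * a m))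

  detP-diagonal zero t = begin
    det R (P t t 1)        ≈⟨ detP-one t t ⟩
    t                      ≈⟨ solve 2 (λ t x → t := t :* ((x :+ :1) :- x :* :1)) refl t x ⟩
    t * (x + 1# - x * 1#)  ≈⟨ *-congˡ (+-congʳ a-one) ⟨
    t * (a 1 - x * a 0)    ∎
  detP-diagonal (suc m) t = begin
    det R (P t t (suc (suc m)))
      ≈⟨ detP-step m t t ⟩
    (t - t * (q * q)) * a₁ + (q * x) * det R (P (t * q) (t * q) (suc m))
      ≈⟨ +-congˡ (*-congˡ (detP-diagonal m (t * q))) ⟩
    (t - t * (q * q)) * a₁ + (q * x) * ((t * q) * (a₁ - x * a₀))
      ≈⟨ solve 5 (λ t q x a₀ a₁ →
           (t :- t :* (q :* q)) :* a₁ :+ (q :* x) :* ((t :* q) :* (a₁ :- x :* a₀))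
           := t :* ((:1 :+ x :- :1 :* (q :* q)) :* a₁
                    :+ (q :* x) :* ((:1 :* q) :* (a₁ :- x :* a₀)) :- x :* a₁))
         refl t q x a₀ a₁ ⟩
    t * ((1# + x - 1# * (q * q)) * a₁ + (q * x) * ((1# * q) * (a₁ - x * a₀)) - x * a₁)
      ≈⟨ *-congˡ (+-congʳ (a-step m)) ⟨
    t * (a (suc (suc m)) - x * a₁) ∎
    where
    a₀ a₁ : Carrier
    a₀ = a m
    a₁ = a (suc m)

  a-step m = begin
    a (suc (suc m))
      ≈⟨ a≈detP (suc m) ⟩
    det R (P (1# + x) 1# (suc (suc m)))
      ≈⟨ detP-step m (1# + x) 1# ⟩
    (1# + x - 1# * (q * q)) * a (suc m) + (q * x) * det R (P (1# * q) (1# * q) (suc m))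
      ≈⟨ +-congˡ (*-congˡ (detP-diagonal m (1# * q))) ⟩
    (1# + x - 1# * (q * q)) * a (suc m) + (q * x) * ((1# * q) * (a (suc m) - x * a m)) ∎

  a-recurrence : LucasRecurrence (1# - pow R q 2 + (1# + pow R q 2) * x) (pow R q 2 * pow R x 2) a
  a-recurrence m = trans (a-step m)
    (solve 4 (λ q x a₀ a₁ →
       (:1 :+ x :- :1 :* (q :* q)) :* a₁ :+ (q :* x) :* ((:1 :* q) :* (a₁ :- x :* a₀))
       := (:1 :- q :* (q :* :1) :+ (:1 :+ q :* (q :* :1)) :* x) :* a₁
          :- (q :* (q :* :1) :* (x :* (x :* :1))) :* a₀)
     refl q x (a m) (a (suc m)))

theorem1p3 : ∀ {c ℓ : Level} (R : CommutativeRing c ℓ) →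
    let open CommutativeRing R in
    ∀ (q x : Carrier) (n : ℕ) → 1 ≤ n →
      det R (qMatrix R q x n)
        ≈ (x + 1#) * lucasU R (1# - pow R q 2 + (1# + pow R q 2) * x) (pow R q 2 * pow R x 2) n
          - (pow R q 2 * pow R x 2)
            * lucasU R (1# - pow R q 2 + (1# + pow R q 2) * x) (pow R q 2 * pow R x 2) (n ∸ 1)
theorem1p3 R q x zero    ()
theorem1p3 R q x (suc n) _ = begin
  a (suc n)                          ≈⟨ recurrence⇒lucasU a-recurrence n ⟩
  a 1 * U (suc n) - (B * a 0) * U n  ≈⟨ +-cong (*-congʳ a-one) (-‿cong (*-congʳ (*-identityʳ B))) ⟩
  (x + 1#) * U (suc n) - B * U n     ∎
  where
  open CommutativeRing R
  open QMatrix R q x using (a; a-one; a-recurrence)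
  open LinearRecurrence R using (recurrence⇒lucasU)
  open import Relation.Binary.Reasoning.Setoid setoid
  B : Carrier
  B = pow R q 2 * pow R x 2
  U : ℕ → Carrier
  U = lucasU R (1# - pow R q 2 + (1# + pow R q 2) * x) B
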